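{- Fix $d\in\mathbb{N}$. The following statements are equivalent: (1) There exists $s\in\mathbb{N}$ such that in every digraph with minimum out-degree at least $d$, every subset of $s$ vertices is separable. (2) In every digraph with minimum out-degree at least $d$, every subset of $d-1$ vertices is separable. (3) The function $t(d,n)$ is unbounded as a function of $n$. (4) $t(d,n)\ge \log(n)-\log(d-2)$ for all $n$.
   Context: Digraphs are finite, without loops and without parallel arcs in the same direction. A friendly partition of a digraph $G=(V,E)$ is an unordered partition $\{V_1,V_2\}$ of $V$ into two nonempty sets such that every vertex has at least one out-neighbor in its own part. A set $S\subseteq V$ is separable if there is a friendly partition $\{V_1,V_2\}$ with $V_1\cap S\neq\emptyset$ and $V_2\cap S\neq\emptyset$. $t(d,n)$ denotes the minimum, over all digraphs with $n$ vertices and minimum out-degree $d$ (at least $d$), of the number of friendly partitions of the digraph. $\log$ is the base-$2$ logarithm. -}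

module Defs where

open import Data.Nat using (ℕ; zero; suc; _≤_; _/_)
open import Data.Bool using (Bool; true; false)
open import Data.Bool.Properties using () renaming (_≟_ to _≟ᵇ_)
open import Data.Fin using (Fin)
open import Data.Fin.Properties using (any?; all?)
open import Data.Fin.Subset using (Subset; _∈_; _∉_; ∁; Nonempty; _∩_; ∣_∣)
open import Data.Fin.Subset.Properties using (nonempty?; _∈?_)
open import Data.Vec using (Vec; []; _∷_; lookup)
open import Data.List using (List; []; _∷_; map; _++_; filter; length)
open import Data.Product using (Σ; ∃; _×_; _,_)
open import Relation.Nullary using (Dec; yes; no)
open import Relation.Nullary.Decidable using (_×-dec_)
open import Relation.Binary.PropositionalEquality using (_≡_)

-- No loops; parallel arcs in the same direction are impossible by construction
-- (adjacency is a set); arcs in both directions u→v, v→u are allowed.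
record Digraph (n : ℕ) : Set where
  field
    out      : Fin n → Subset n
    loopless : ∀ v → v ∉ out v
open Digraph public

outDeg : ∀ {n} → Digraph n → Fin n → ℕ
outDeg G v = ∣ out G v ∣

MinOutDeg≥ : ∀ {n} → Digraph n → ℕ → Set
MinOutDeg≥ G d = ∀ v → d ≤ outDeg G v

-- A subset P ⊆ V encodes the partition {P, V∖P}. It is friendly iff both
-- parts are nonempty and every vertex has an out-neighbour in its own part.
Friendly : ∀ {n} → Digraph n → Subset n → Set
Friendly {n} G P =
  Nonempty P × Nonempty (∁ P) ×
  (∀ (v : Fin n) → ∃ λ (u : Fin n) → u ∈ out G v × lookup P u ≡ lookup P v)

friendly? : ∀ {n} (G : Digraph n) (P : Subset n) → Dec (Friendly G P)
friendly? G P =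
  nonempty? P ×-dec nonempty? (∁ P) ×-dec
  all? (λ v → any? (λ u → (u ∈? out G v) ×-dec (lookup P u ≟ᵇ lookup P v)))

allSubsets : ∀ n → List (Subset n)
allSubsets zero = [] ∷ []
allSubsets (suc n) = map (true ∷_) (allSubsets n) ++ map (false ∷_) (allSubsets n)

-- number of (unordered) friendly partitions: each unordered partition {P, V∖P}
-- is counted twice among the subsets P, hence the division by 2.
friendlyCount : ∀ {n} → Digraph n → ℕ
friendlyCount {n} G = length (filter (friendly? G) (allSubsets n)) / 2

Separable : ∀ {n} → Digraph n → Subset n → Set
Separable G S = ∃ λ P → Friendly G P × Nonempty (P ∩ S) × Nonempty (∁ P ∩ S)

-- "t(d,n) ≥ k": every digraph on n vertices with min out-degree ≥ d has at
-- least k friendly partitions (t(d,n) is the minimum of these counts).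
t≥ : ℕ → ℕ → ℕ → Set
t≥ d n k = (G : Digraph n) → MinOutDeg≥ G d → k ≤ friendlyCount G

-- If every s-set is separable, friendly partitions can be found one at a time: given k of them,
-- more than (s - 1)·2^k vertices contain s vertices on which all k agree, and a friendly partition
-- separating these s vertices is new.  So n ≤ (s - 1)·2^t for a digraph with t friendly partitions,
-- which gives (1) ⇒ (3) and (2) ⇒ (4) ⇒ (3).  Conversely, if d - 1 vertices S of G are not
-- separable, attach to G a directed cycle of any length ≥ 2 whose vertices also point to all of S.
-- The minimum out-degree stays d; a friendly partition of the result is constant on S (else it
-- would separate S in G) and hence on the cycle, so it is determined by its trace on G and one
-- bit.  Thus t(d, N) ≤ 2^(|G| + 1) for every N > d, refuting (3).

module Submission where

open import Defs
open import Data.Nat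
  using (ℕ; zero; suc; _+_; _≤_; _<_; _∸_; _*_; _^_; _/_; z≤n; s≤s; _≤?_; _<?_)
open import Data.Nat.Properties
open import Data.Nat.DivMod using (m/n≤m; m*n/n≡m; /-monoˡ-≤)
open import Data.Bool using (true; false; not)
open import Data.Bool.Properties using (not-injective; not-¬; ¬-not) renaming (_≟_ to _≟ᵇ_)
open import Data.Fin using (Fin; zero; suc; fromℕ; inject₁; toℕ; _↑ˡ_; _↑ʳ_; splitAt)
open import Data.Fin.Properties
  using (toℕ-inject₁; splitAt-↑ˡ; splitAt-↑ʳ; splitAt⁻¹-↑ˡ; splitAt⁻¹-↑ʳ)
open import Data.Fin.Induction using (<-weakInduction; >-weakInduction)
open import Data.Fin.Subset
  using (Subset; _∈_; _∉_; _⊆_; ∁; _∩_; ⊤; ⊥; ⁅_⁆; Nonempty; ∣_∣)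
open import Data.Fin.Subset.Properties
  using ( ∉⊥; ⊥⊆; ∣⊥∣≡0; ∣⊤∣≡n; s⊆s; x∈⁅x⁆; x∈⁅y⁆⇒x≡y; ∣⁅x⁆∣≡1; ∣∁p∣≡n∸∣p∣
        ; x∈p⇒x∉∁p; x∈∁p⇒x∉p; x∉p⇒x∈∁p; p∩q⊆p; x∈p∩q⁺; x∈p∩q⁻
        ; nonempty?; Empty-unique; anySubset?)
open import Data.Vec using (Vec; []; _∷_; lookup; tabulate; _++_)
open import Data.Vec.Properties
  using ([]=⇒lookup; lookup⇒[]=; lookup-map; lookup-++ˡ; lookup-++ʳ; lookup∘tabulate
        ; tabulate∘lookup; tabulate-cong; ∷-injectiveˡ; ∷-injectiveʳ)
open import Data.List using (List; []; _∷_; length; filter)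
import Data.List as List
open import Data.List.Properties using (length-map; length-++; length-++-sucʳ)
open import Data.List.Membership.Propositional using () renaming (_∈_ to _∈ˡ_)
open import Data.List.Membership.Propositional.Properties
  using (∈-map⁺; ∈-map⁻; ∈-++⁺ˡ; ∈-++⁺ʳ; ∈-++⁻; ∈-∃++; ∈-filter⁺; ∈-filter⁻)
open import Data.List.Relation.Unary.Any using (here; there)
open import Data.List.Relation.Unary.All using (All; []; _∷_)
import Data.List.Relation.Unary.All as All
open import Data.List.Relation.Unary.AllPairs using (AllPairs; []; _∷_)
open import Data.List.Relation.Unary.Unique.Propositional using (Unique)
import Data.List.Relation.Unary.Unique.Propositional.Properties as Unique
open import Data.Product using (∃; _×_; _,_; proj₁; proj₂)
open import Data.Sum using (_⊎_; inj₁; inj₂)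
open import Data.Empty using (⊥-elim)
open import Function using (id; _∘_)
open import Function.Bundles using (_⇔_; mk⇔)
open import Relation.Nullary using (¬_; Dec; yes; no; contradiction)
open import Relation.Nullary.Decidable using (_×-dec_; ¬?; decidable-stable)
open import Relation.Unary using (Pred; Decidable)
open import Relation.Binary.PropositionalEquality

lookup-∁ : ∀ {n} (p : Subset n) x → lookup (∁ p) x ≡ not (lookup p x)
lookup-∁ p x = lookup-map x not p

lookup≡true⇒∈ : ∀ {n} {p : Subset n} {x} → lookup p x ≡ true → x ∈ p
lookup≡true⇒∈ {p = p} {x} = lookup⇒[]= x p

lookup≡false⇒∈∁ : ∀ {n} {p : Subset n} {x} → lookup p x ≡ false → x ∈ ∁ p
lookup≡false⇒∈∁ {p = p} {x} eq = lookup⇒[]= x (∁ p) (trans (lookup-∁ p x) (cong not eq))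

∈-++⁻ˡ : ∀ {r m} (p : Subset r) (q : Subset m) {y} → y ↑ˡ m ∈ p ++ q → y ∈ p
∈-++⁻ˡ p q {y} y∈ = lookup≡true⇒∈ (trans (sym (lookup-++ˡ p q y)) ([]=⇒lookup y∈))

∈-++⁻ʳ : ∀ {r m} (p : Subset r) (q : Subset m) {v} → r ↑ʳ v ∈ p ++ q → v ∈ q
∈-++⁻ʳ p q {v} v∈ = lookup≡true⇒∈ (trans (sym (lookup-++ʳ p q v)) ([]=⇒lookup v∈))

lookup-extensionality : ∀ {A : Set} {n} (xs ys : Vec A n) →
  (∀ i → lookup xs i ≡ lookup ys i) → xs ≡ ys
lookup-extensionality xs ys eq =
  trans (sym (tabulate∘lookup xs)) (trans (tabulate-cong eq) (tabulate∘lookup ys))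

∣p++q∣≡∣p∣+∣q∣ : ∀ {m n} (p : Subset m) (q : Subset n) → ∣ p ++ q ∣ ≡ ∣ p ∣ + ∣ q ∣
∣p++q∣≡∣p∣+∣q∣ []          q = refl
∣p++q∣≡∣p∣+∣q∣ (true  ∷ p) q = cong suc (∣p++q∣≡∣p∣+∣q∣ p q)
∣p++q∣≡∣p∣+∣q∣ (false ∷ p) q = ∣p++q∣≡∣p∣+∣q∣ p q

∣p∩q∣+∣p∩∁q∣≡∣p∣ : ∀ {n} (p q : Subset n) → ∣ p ∩ q ∣ + ∣ p ∩ ∁ q ∣ ≡ ∣ p ∣
∣p∩q∣+∣p∩∁q∣≡∣p∣ []          []          = refl
∣p∩q∣+∣p∩∁q∣≡∣p∣ (true  ∷ p) (true  ∷ q) = cong suc (∣p∩q∣+∣p∩∁q∣≡∣p∣ p q)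
∣p∩q∣+∣p∩∁q∣≡∣p∣ (true  ∷ p) (false ∷ q) =
  trans (+-suc _ _) (cong suc (∣p∩q∣+∣p∩∁q∣≡∣p∣ p q))
∣p∩q∣+∣p∩∁q∣≡∣p∣ (false ∷ p) (_     ∷ q) = ∣p∩q∣+∣p∩∁q∣≡∣p∣ p q

∃-⊆-of-size : ∀ {n s} (p : Subset n) → s ≤ ∣ p ∣ → ∃ λ q → q ⊆ p × ∣ q ∣ ≡ s
∃-⊆-of-size {n} {zero} p _ = ⊥ , ⊥⊆ , ∣⊥∣≡0 n
∃-⊆-of-size {s = suc s} (true ∷ p) (s≤s s≤∣p∣) =
  let q , q⊆p , ∣q∣≡s = ∃-⊆-of-size p s≤∣p∣ in true ∷ q , s⊆s q⊆p , cong suc ∣q∣≡s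
∃-⊆-of-size {s = suc s} (false ∷ p) s<∣p∣ =
  let q , q⊆p , ∣q∣≡s = ∃-⊆-of-size p s<∣p∣ in false ∷ q , s⊆s q⊆p , ∣q∣≡s

∣p∣≡suc⇒nonempty : ∀ {n k} (p : Subset n) → ∣ p ∣ ≡ suc k → Nonempty p
∣p∣≡suc⇒nonempty {n} p ∣p∣≡1+k with nonempty? p
... | yes ne = ne
... | no ¬ne =
  contradiction (trans (sym ∣p∣≡1+k) (trans (cong ∣_∣ (Empty-unique ¬ne)) (∣⊥∣≡0 n))) λ ()

allSubsets-complete : ∀ {n} (p : Subset n) → p ∈ˡ allSubsets n
allSubsets-complete []          = here refl
allSubsets-complete (true  ∷ p) = ∈-++⁺ˡ (∈-map⁺ (true ∷_) (allSubsets-complete p))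
allSubsets-complete {suc n} (false ∷ p) =
  ∈-++⁺ʳ (List.map (true ∷_) (allSubsets n)) (∈-map⁺ (false ∷_) (allSubsets-complete p))

allSubsets-unique : ∀ n → Unique (allSubsets n)
allSubsets-unique zero    = [] ∷ []
allSubsets-unique (suc n) =
  Unique.++⁺ (Unique.map⁺ ∷-injectiveʳ (allSubsets-unique n))
             (Unique.map⁺ ∷-injectiveʳ (allSubsets-unique n)) disjoint
  where
  disjoint : ∀ {p} → ¬ (p ∈ˡ List.map (true ∷_) (allSubsets n) ×
                        p ∈ˡ List.map (false ∷_) (allSubsets n))
  disjoint (p∈ , p∈′) with ∈-map⁻ (true ∷_) p∈ | ∈-map⁻ (false ∷_) p∈′
  ... | _ , _ , refl | _ , _ , ()

length-allSubsets : ∀ n → length (allSubsets n) ≡ 2 ^ n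
length-allSubsets zero    = refl
length-allSubsets (suc n) = begin
  length (allSubsets (suc n))
    ≡⟨ length-++ (List.map (true ∷_) (allSubsets n)) ⟩
  length (List.map (true ∷_) (allSubsets n)) + length (List.map (false ∷_) (allSubsets n))
    ≡⟨ cong₂ _+_ (length-map (true ∷_) (allSubsets n)) (length-map (false ∷_) (allSubsets n)) ⟩
  length (allSubsets n) + length (allSubsets n)
    ≡⟨ cong (λ k → k + k) (length-allSubsets n) ⟩
  2 ^ n + 2 ^ n
    ≡⟨ cong (2 ^ n +_) (sym (+-identityʳ (2 ^ n))) ⟩
  2 ^ suc n ∎
  where open ≡-Reasoning

length-≤-of-injective : ∀ {A B : Set} (f : A → B) {xs : List A} {ys : List B} → Unique xs →
  (∀ {x y} → x ∈ˡ xs → y ∈ˡ xs → f x ≡ f y → x ≡ y) →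
  (∀ {x} → x ∈ˡ xs → f x ∈ˡ ys) → length xs ≤ length ys
length-≤-of-injective f {[]} _ _ _ = z≤n
length-≤-of-injective f {x ∷ xs} (x∉xs ∷ unique) injective into
  with ∈-∃++ (into (here refl))
... | us , vs , refl = begin
  suc (length xs)                ≤⟨ s≤s (length-≤-of-injective f unique injective′ into′) ⟩
  suc (length (us List.++ vs)) ≡⟨ length-++-sucʳ us (f x) vs ⟨
  length (us List.++ f x ∷ vs) ∎
  where
  open ≤-Reasoning
  injective′ : ∀ {y z} → y ∈ˡ xs → z ∈ˡ xs → f y ≡ f z → y ≡ z
  injective′ y∈ z∈ = injective (there y∈) (there z∈)
  into′ : ∀ {y} → y ∈ˡ xs → f y ∈ˡ us List.++ vs
  into′ y∈ with ∈-++⁻ us (into (there y∈))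
  ... | inj₁ fy∈us          = ∈-++⁺ˡ fy∈us
  ... | inj₂ (here fy≡fx)   =
    contradiction (sym (injective (there y∈) (here refl) fy≡fx)) (All.lookup x∉xs y∈)
  ... | inj₂ (there fy∈vs)  = ∈-++⁺ʳ us fy∈vs

friendlySubsets : ∀ {n} → Digraph n → List (Subset n)
friendlySubsets {n} G = filter (friendly? G) (allSubsets n)

length/2≤friendlyCount : ∀ {n} (G : Digraph n) {Ps : List (Subset n)} →
  Unique Ps → All (Friendly G) Ps → length Ps / 2 ≤ friendlyCount G
length/2≤friendlyCount G unique friendly = /-monoˡ-≤ 2
  (length-≤-of-injective id unique (λ _ _ → id)
    (λ P∈ → ∈-filter⁺ (friendly? G) (allSubsets-complete _) (All.lookup friendly P∈)))

friendlyCount≤2^ : ∀ {n k} (G : Digraph n) (f : Subset n → Subset k) →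
  (∀ {P Q} → Friendly G P → Friendly G Q → f P ≡ f Q → P ≡ Q) → friendlyCount G ≤ 2 ^ k
friendlyCount≤2^ {n} {k} G f injective = begin
  friendlyCount G             ≤⟨ m/n≤m _ 2 ⟩
  length (friendlySubsets G)  ≤⟨ length-≤-of-injective f
                                   (Unique.filter⁺ (friendly? G) (allSubsets-unique n))
                                   (λ P∈ Q∈ → injective (friendly-of P∈) (friendly-of Q∈))
                                   (λ _ → allSubsets-complete _) ⟩
  length (allSubsets k)       ≡⟨ length-allSubsets k ⟩
  2 ^ k                       ∎
  where
  open ≤-Reasoning
  friendly-of : ∀ {P} → P ∈ˡ friendlySubsets G → Friendly G P
  friendly-of = proj₂ ∘ ∈-filter⁻ (friendly? G) {xs = allSubsets n}

Cohesive : ∀ {n} → Digraph n → Subset n → Set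
Cohesive {n} G P = ∀ (v : Fin n) → ∃ λ u → u ∈ out G v × lookup P u ≡ lookup P v

friendly-∁ : ∀ {n} {G : Digraph n} {P} → Friendly G P → Friendly G (∁ P)
friendly-∁ {P = P} ((v , v∈P) , v∉P , cohesive) =
  v∉P , (v , x∉p⇒x∈∁p (x∈p⇒x∉∁p v∈P)) , λ w →
    let u , u∈ , same = cohesive w
    in u , u∈ , trans (lookup-∁ P u) (trans (cong not same) (sym (lookup-∁ P w)))

friendly⇒≢∁ : ∀ {n} {G : Digraph n} {P} → Friendly G P → P ≢ ∁ P
friendly⇒≢∁ {P = P} ((v , _) , _) P≡∁P =
  not-¬ refl (trans (cong (λ Q → lookup Q v) P≡∁P) (lookup-∁ P v))

separated-by : ∀ {n} {G : Digraph n} {P S : Subset n} {a c} → Cohesive G P →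
  a ∈ P ∩ S → c ∈ ∁ P ∩ S → Separable G S
separated-by {P = P} {S} cohesive a∈ c∈ =
  P , ((_ , proj₁ (x∈p∩q⁻ P S a∈)) , (_ , proj₁ (x∈p∩q⁻ (∁ P) S c∈)) , cohesive) ,
  (_ , a∈) , (_ , c∈)

separable? : ∀ {n} (G : Digraph n) (S : Subset n) → Dec (Separable G S)
separable? G S =
  anySubset? (λ P → friendly? G P ×-dec nonempty? (P ∩ S) ×-dec nonempty? (∁ P ∩ S))

data Distinguishes {n} (P Q : Subset n) : Set where
  distinguish : ∀ {v w} → lookup Q v ≡ lookup Q w → lookup P v ≢ lookup P w → Distinguishes P Q

distinguishes⇒≢ : ∀ {n} {P Q : Subset n} → Distinguishes P Q → P ≢ Q
distinguishes⇒≢ (distinguish Qv≡Qw Pv≢Pw) refl = Pv≢Pw Qv≡Qw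

distinguishes-∁ˡ : ∀ {n} {P Q : Subset n} → Distinguishes P Q → Distinguishes (∁ P) Q
distinguishes-∁ˡ {P = P} (distinguish {v} {w} Qv≡Qw Pv≢Pw) =
  distinguish Qv≡Qw λ eq →
    Pv≢Pw (not-injective (trans (sym (lookup-∁ P v)) (trans eq (lookup-∁ P w))))

distinguishes-∁ʳ : ∀ {n} {P Q : Subset n} → Distinguishes P Q → Distinguishes P (∁ Q)
distinguishes-∁ʳ {Q = Q} (distinguish {v} {w} Qv≡Qw Pv≢Pw) =
  distinguish (trans (lookup-∁ Q v) (trans (cong not Qv≡Qw) (sym (lookup-∁ Q w)))) Pv≢Pw

withComplements : ∀ {n} → List (Subset n) → List (Subset n)
withComplements []       = []
withComplements (P ∷ Ps) = P ∷ ∁ P ∷ withComplements Ps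

length-withComplements : ∀ {n} (Ps : List (Subset n)) →
  length (withComplements Ps) ≡ length Ps * 2
length-withComplements []       = refl
length-withComplements (P ∷ Ps) = cong (λ k → suc (suc k)) (length-withComplements Ps)

withComplements-friendly : ∀ {n} {G : Digraph n} {Ps} →
  All (Friendly G) Ps → All (Friendly G) (withComplements Ps)
withComplements-friendly         []              = []
withComplements-friendly {G = G} (friendly ∷ fs) =
  friendly ∷ friendly-∁ {G = G} friendly ∷ withComplements-friendly {G = G} fs

distinguishes⇒∉withComplements : ∀ {n} {P : Subset n} {Qs} →
  All (Distinguishes P) Qs → All (P ≢_) (withComplements Qs)
distinguishes⇒∉withComplements []       = []
distinguishes⇒∉withComplements (d ∷ ds) =
  distinguishes⇒≢ d ∷ distinguishes⇒≢ (distinguishes-∁ʳ d) ∷ distinguishes⇒∉withComplements ds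

-- Distinguishing pairs make the partitions of a chain pairwise distinct, even up to complement.
FriendlyChain : ∀ {n} → Digraph n → List (Subset n) → Set
FriendlyChain G Ps = All (Friendly G) Ps × AllPairs Distinguishes Ps

withComplements-unique : ∀ {n} {G : Digraph n} {Ps} → FriendlyChain G Ps →
  Unique (withComplements Ps)
withComplements-unique         ([] , [])                  = []
withComplements-unique {G = G} (friendly ∷ fs , ds ∷ dss) =
  (friendly⇒≢∁ {G = G} friendly ∷ distinguishes⇒∉withComplements ds)
  ∷ distinguishes⇒∉withComplements (All.map distinguishes-∁ˡ ds)
  ∷ withComplements-unique {G = G} (fs , dss)

chain-length≤friendlyCount : ∀ {n} {G : Digraph n} {Ps} → FriendlyChain G Ps →
  length Ps ≤ friendlyCount G
chain-length≤friendlyCount {G = G} {Ps} chain = begin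
  length Ps                        ≡⟨ m*n/n≡m (length Ps) 2 ⟨
  length Ps * 2 / 2                ≡⟨ cong (_/ 2) (length-withComplements Ps) ⟨
  length (withComplements Ps) / 2  ≤⟨ length/2≤friendlyCount G
                                        (withComplements-unique {G = G} chain)
                                        (withComplements-friendly {G = G} (proj₁ chain)) ⟩
  friendlyCount G                  ∎
  where open ≤-Reasoning

-- Many friendly partitions from separability

ConstantOn : ∀ {n} → Subset n → Subset n → Set
ConstantOn W Q = ∀ {v w} → v ∈ W → w ∈ W → lookup Q v ≡ lookup Q w

⊆⇒constantOn : ∀ {n} {W Q : Subset n} → W ⊆ Q → ConstantOn W Q
⊆⇒constantOn W⊆Q v∈W w∈W = trans ([]=⇒lookup (W⊆Q v∈W)) (sym ([]=⇒lookup (W⊆Q w∈W)))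

⊆∁⇒constantOn : ∀ {n} {W Q : Subset n} → W ⊆ ∁ Q → ConstantOn W Q
⊆∁⇒constantOn {Q = Q} W⊆∁Q {v} {w} v∈W w∈W = not-injective (begin
  not (lookup Q v)  ≡⟨ lookup-∁ Q v ⟨
  lookup (∁ Q) v    ≡⟨ ⊆⇒constantOn W⊆∁Q v∈W w∈W ⟩
  lookup (∁ Q) w    ≡⟨ lookup-∁ Q w ⟩
  not (lookup Q w)  ∎)
  where open ≡-Reasoning

+-<-split : ∀ {c a b} → c + c < a + b → c < a ⊎ c < b
+-<-split {c} {a} {b} c+c<a+b with c <? a
... | yes c<a = inj₁ c<a
... | no  c≮a = inj₂ (+-cancelˡ-< c c b (<-≤-trans c+c<a+b (+-monoˡ-≤ b (≮⇒≥ c≮a))))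

-- Pigeonhole over the 2 ^ length Qs cells cut out by the subsets Qs.
homogeneous-subset : ∀ {n} s (Qs : List (Subset n)) (U : Subset n) →
  (s ∸ 1) * 2 ^ length Qs < ∣ U ∣ →
  ∃ λ W → W ⊆ U × ∣ W ∣ ≡ s × All (ConstantOn W) Qs
homogeneous-subset s [] U big =
  let W , W⊆U , ∣W∣≡s =
        ∃-⊆-of-size U (≤-trans (m≤n+m∸n s 1) (subst (_< ∣ U ∣) (*-identityʳ (s ∸ 1)) big))
  in W , W⊆U , ∣W∣≡s , []
homogeneous-subset s (Q ∷ Qs) U big
  with +-<-split (subst₂ _<_ (doubling (s ∸ 1) (2 ^ length Qs)) (sym (∣p∩q∣+∣p∩∁q∣≡∣p∣ U Q)) big)
  where
  doubling : ∀ a x → a * (2 * x) ≡ a * x + a * x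
  doubling a x = trans (cong (a *_) (cong (x +_) (+-identityʳ x))) (*-distribˡ-+ a x x)
... | inj₁ big∩ =
  let W , W⊆U∩Q , ∣W∣≡s , constant = homogeneous-subset s Qs (U ∩ Q) big∩
  in W , p∩q⊆p U Q ∘ W⊆U∩Q , ∣W∣≡s , ⊆⇒constantOn (proj₂ ∘ x∈p∩q⁻ U Q ∘ W⊆U∩Q) ∷ constant
... | inj₂ big∩∁ =
  let W , W⊆U∩∁Q , ∣W∣≡s , constant = homogeneous-subset s Qs (U ∩ ∁ Q) big∩∁
  in W , p∩q⊆p U (∁ Q) ∘ W⊆U∩∁Q , ∣W∣≡s , ⊆∁⇒constantOn (proj₂ ∘ x∈p∩q⁻ U (∁ Q) ∘ W⊆U∩∁Q) ∷ constant

SeparableOfSize : ∀ {n} → Digraph n → ℕ → Set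
SeparableOfSize {n} G s = ∀ (S : Subset n) → ∣ S ∣ ≡ s → Separable G S

extend-chain : ∀ {n} (G : Digraph n) {s} → SeparableOfSize G s → ∀ {Ps} → FriendlyChain G Ps →
  (s ∸ 1) * 2 ^ length Ps < n → ∃ λ P → FriendlyChain G (P ∷ Ps)
extend-chain {n} G {s} separable {Ps} (friendly , distinct) big
  with homogeneous-subset s Ps ⊤ (subst ((s ∸ 1) * 2 ^ length Ps <_) (sym (∣⊤∣≡n n)) big)
... | W , _ , ∣W∣≡s , constant
  with separable W ∣W∣≡s
... | P , friendlyP , (v , v∈P∩W) , (w , w∈∁P∩W) =
  P , friendlyP ∷ friendly , All.map splits constant ∷ distinct
  where
  v∈P = proj₁ (x∈p∩q⁻ P W v∈P∩W)
  w∉P = x∈∁p⇒x∉p (proj₁ (x∈p∩q⁻ (∁ P) W w∈∁P∩W))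
  splits : ∀ {Q} → ConstantOn W Q → Distinguishes P Q
  splits constantQ =
    distinguish (constantQ (proj₂ (x∈p∩q⁻ P W v∈P∩W)) (proj₂ (x∈p∩q⁻ (∁ P) W w∈∁P∩W)))
                (λ Pv≡Pw → w∉P (lookup≡true⇒∈ (trans (sym Pv≡Pw) ([]=⇒lookup v∈P))))

long-chain : ∀ {n} (G : Digraph n) {s} → SeparableOfSize G s →
  ∀ j → (s ∸ 1) * 2 ^ j < n → ∃ λ Ps → length Ps ≡ suc j × FriendlyChain G Ps
long-chain G separable zero big =
  let P , chain = extend-chain G separable ([] , []) big in P ∷ [] , refl , chain
long-chain G {s} separable (suc j) big
  with long-chain G separable j (≤-<-trans (*-monoʳ-≤ (s ∸ 1) (^-monoʳ-≤ 2 (n≤1+n j))) big)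
... | Ps , length≡ , chain =
  let P , chain′ =
        extend-chain G separable chain (subst (λ k → (s ∸ 1) * 2 ^ k < _) (sym length≡) big)
  in P ∷ Ps , cong suc length≡ , chain′

separable⇒friendlyCount≥ : ∀ {n} (G : Digraph n) {s} → SeparableOfSize G s →
  ∀ j → (s ∸ 1) * 2 ^ j < n → suc j ≤ friendlyCount G
separable⇒friendlyCount≥ G separable j big =
  let Ps , length≡ , chain = long-chain G separable j big
  in subst (_≤ friendlyCount G) length≡ (chain-length≤friendlyCount {G = G} chain)

-- Few friendly partitions from a non-separable set

prev : ∀ {k} → Fin (suc k) → Fin (suc k)
prev {k} zero = fromℕ k
prev (suc i)  = inject₁ i

i≢prev[i] : ∀ {k} (i : Fin (suc (suc k))) → i ≢ prev i
i≢prev[i] zero    ()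
i≢prev[i] (suc i) eq = 1+n≢n (trans (cong toℕ eq) (toℕ-inject₁ i))

prev-closed⇒all-or-none : ∀ {k ℓ} {C : Pred (Fin (suc k)) ℓ} → Decidable C →
  (∀ i → C i → C (prev i)) → (∀ i → C i) ⊎ (∀ i → ¬ C i)
prev-closed⇒all-or-none {k} {C = C} C? closed with C? (fromℕ k)
... | yes C[last] = inj₁ (>-weakInduction C C[last] (λ i → closed (suc i)))
... | no ¬C[last] = inj₂ (<-weakInduction (¬_ ∘ C) (¬C[last] ∘ closed zero)
                           (λ i ¬C[i] C[1+i] → ¬C[i] (closed (suc i) C[1+i])))

data BlockView (r m : ℕ) : Fin (r + m) → Set where
  inˡ : (y : Fin r) → BlockView r m (y ↑ˡ m)
  inʳ : (v : Fin m) → BlockView r m (r ↑ʳ v)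

blockView : ∀ r m (i : Fin (r + m)) → BlockView r m i
blockView r m i with splitAt r i in eq
... | inj₁ y = subst (BlockView r m) (splitAt⁻¹-↑ˡ eq) (inˡ y)
... | inj₂ v = subst (BlockView r m) (splitAt⁻¹-↑ʳ eq) (inʳ v)

-- G⁺ puts k + 2 new vertices y in front of G, with arcs y → prev y (a directed cycle) and y → S.
module CycleGadget {m} (G : Digraph m) (S : Subset m) (k : ℕ) where

  r : ℕ
  r = suc (suc k)

  blockOut : Fin r ⊎ Fin m → Subset (r + m)
  blockOut (inj₁ y) = ⁅ prev y ⁆ ++ S
  blockOut (inj₂ v) = ⊥ ++ out G v

  out⁺ : Fin (r + m) → Subset (r + m)
  out⁺ i = blockOut (splitAt r i)

  out⁺-↑ˡ : ∀ y → out⁺ (y ↑ˡ m) ≡ ⁅ prev y ⁆ ++ S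
  out⁺-↑ˡ y = cong blockOut (splitAt-↑ˡ r y m)

  out⁺-↑ʳ : ∀ v → out⁺ (r ↑ʳ v) ≡ ⊥ ++ out G v
  out⁺-↑ʳ v = cong blockOut (splitAt-↑ʳ r m v)

  ↑ˡ∈out⁺-↑ˡ⇒prev : ∀ {y z} → z ↑ˡ m ∈ out⁺ (y ↑ˡ m) → z ≡ prev y
  ↑ˡ∈out⁺-↑ˡ⇒prev {y} z∈ = x∈⁅y⁆⇒x≡y (prev y) (∈-++⁻ˡ ⁅ prev y ⁆ S (subst (_ ∈_) (out⁺-↑ˡ y) z∈))

  ↑ʳ∈out⁺-↑ˡ⇒∈S : ∀ {y a} → r ↑ʳ a ∈ out⁺ (y ↑ˡ m) → a ∈ S
  ↑ʳ∈out⁺-↑ˡ⇒∈S {y} a∈ = ∈-++⁻ʳ ⁅ prev y ⁆ S (subst (_ ∈_) (out⁺-↑ˡ y) a∈)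

  ↑ˡ∉out⁺-↑ʳ : ∀ {v z} → z ↑ˡ m ∉ out⁺ (r ↑ʳ v)
  ↑ˡ∉out⁺-↑ʳ {v} z∈ = ∉⊥ (∈-++⁻ˡ ⊥ (out G v) (subst (_ ∈_) (out⁺-↑ʳ v) z∈))

  ↑ʳ∈out⁺-↑ʳ⇒∈out : ∀ {v u} → r ↑ʳ u ∈ out⁺ (r ↑ʳ v) → u ∈ out G v
  ↑ʳ∈out⁺-↑ʳ⇒∈out {v} u∈ = ∈-++⁻ʳ ⊥ (out G v) (subst (_ ∈_) (out⁺-↑ʳ v) u∈)

  loopless⁺ : ∀ i → i ∉ out⁺ i
  loopless⁺ i with blockView r m i
  ... | inˡ y = i≢prev[i] y ∘ ↑ˡ∈out⁺-↑ˡ⇒prev {y}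
  ... | inʳ v = loopless G v ∘ ↑ʳ∈out⁺-↑ʳ⇒∈out {v}

  G⁺ : Digraph (r + m)
  G⁺ = record { out = out⁺ ; loopless = loopless⁺ }

  minOutDeg⁺ : ∀ {d} → 1 ≤ d → ∣ S ∣ ≡ d ∸ 1 → MinOutDeg≥ G d → MinOutDeg≥ G⁺ d
  minOutDeg⁺ {d} 1≤d ∣S∣≡d-1 δ i with blockView r m i
  ... | inˡ y = ≤-reflexive (begin
    d                        ≡⟨ m+[n∸m]≡n 1≤d ⟨
    1 + (d ∸ 1)              ≡⟨ cong₂ _+_ (∣⁅x⁆∣≡1 (prev y)) ∣S∣≡d-1 ⟨
    ∣ ⁅ prev y ⁆ ∣ + ∣ S ∣   ≡⟨ ∣p++q∣≡∣p∣+∣q∣ ⁅ prev y ⁆ S ⟨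
    ∣ ⁅ prev y ⁆ ++ S ∣      ≡⟨ cong ∣_∣ (out⁺-↑ˡ y) ⟨
    ∣ out⁺ (y ↑ˡ m) ∣        ∎)
    where open ≡-Reasoning
  ... | inʳ v = subst (d ≤_) (sym (begin
    ∣ out⁺ (r ↑ʳ v) ∣          ≡⟨ cong ∣_∣ (out⁺-↑ʳ v) ⟩
    ∣ ⊥ {r} ++ out G v ∣       ≡⟨ ∣p++q∣≡∣p∣+∣q∣ (⊥ {r}) (out G v) ⟩
    ∣ ⊥ {r} ∣ + ∣ out G v ∣    ≡⟨ cong (_+ ∣ out G v ∣) (∣⊥∣≡0 r) ⟩
    ∣ out G v ∣                ∎)) (δ v)
    where open ≡-Reasoning

  restrict : Subset (r + m) → Subset m
  restrict P = tabulate (λ v → lookup P (r ↑ʳ v))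

  restrict-cohesive : ∀ {P} → Cohesive G⁺ P → Cohesive G (restrict P)
  restrict-cohesive {P} cohesive v with cohesive (r ↑ʳ v)
  ... | u′ , u′∈ , same with blockView r m u′
  ...   | inˡ _ = ⊥-elim (↑ˡ∉out⁺-↑ʳ {v} u′∈)
  ...   | inʳ u = u , ↑ʳ∈out⁺-↑ʳ⇒∈out {v} u′∈ ,
                  trans (lookup∘tabulate _ u) (trans same (sym (lookup∘tabulate _ v)))

  encode : Subset (r + m) → Subset (suc m)
  encode P = lookup P (zero ↑ˡ m) ∷ restrict P

  module _ (nonseparable : ¬ Separable G S) {x₀} (x₀∈S : x₀ ∈ S) where

    module _ {P} (friendly : Friendly G⁺ P) where

      private
        Q = restrict P
        b = lookup P (r ↑ʳ x₀)
        cohesive = restrict-cohesive {P} (proj₂ (proj₂ friendly))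

      restrict-constantOn-S : ∀ {a} → a ∈ S → lookup Q a ≡ lookup Q x₀
      restrict-constantOn-S {a} a∈S with lookup Q a in Qa | lookup Q x₀ in Qx₀
      ... | true  | true  = refl
      ... | false | false = refl
      ... | true  | false = ⊥-elim (nonseparable (separated-by {G = G} {P = Q} cohesive
        (x∈p∩q⁺ (lookup≡true⇒∈ {p = Q} Qa , a∈S)) (x∈p∩q⁺ (lookup≡false⇒∈∁ {p = Q} Qx₀ , x₀∈S))))
      ... | false | true  = ⊥-elim (nonseparable (separated-by {G = G} {P = Q} cohesive
        (x∈p∩q⁺ (lookup≡true⇒∈ {p = Q} Qx₀ , x₀∈S)) (x∈p∩q⁺ (lookup≡false⇒∈∁ {p = Q} Qa , a∈S))))

      side-of-S : ∀ {a} → a ∈ S → lookup P (r ↑ʳ a) ≡ b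
      side-of-S {a} a∈S =
        trans (sym (lookup∘tabulate _ a)) (trans (restrict-constantOn-S a∈S) (lookup∘tabulate _ x₀))

      -- A cycle vertex off S's side cannot use S, so its own-side neighbour is its predecessor.
      off-side-closed : ∀ y → lookup P (y ↑ˡ m) ≢ b → lookup P (prev y ↑ˡ m) ≢ b
      off-side-closed y off with proj₂ (proj₂ friendly) (y ↑ˡ m)
      ... | u′ , u′∈ , same with blockView r m u′
      ...   | inˡ z =
        subst (λ z → lookup P (z ↑ˡ m) ≢ b) (↑ˡ∈out⁺-↑ˡ⇒prev {y} u′∈) (off ∘ trans (sym same))
      ...   | inʳ a = ⊥-elim (off (trans (sym same) (side-of-S (↑ʳ∈out⁺-↑ˡ⇒∈S {y} u′∈))))

      cycle-constant : ∀ y → lookup P (y ↑ˡ m) ≡ lookup P (zero ↑ˡ m)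
      cycle-constant y
        with prev-closed⇒all-or-none (λ z → ¬? (lookup P (z ↑ˡ m) ≟ᵇ b)) off-side-closed
      ... | inj₁ off  = trans (¬-not (off y)) (sym (¬-not (off zero)))
      ... | inj₂ ¬off = trans (decidable-stable (_ ≟ᵇ b) (¬off y))
                              (sym (decidable-stable (_ ≟ᵇ b) (¬off zero)))

    encode-injective : ∀ {P Q} → Friendly G⁺ P → Friendly G⁺ Q → encode P ≡ encode Q → P ≡ Q
    encode-injective {P} {Q} friendlyP friendlyQ eq = lookup-extensionality P Q pointwise
      where
      pointwise : ∀ i → lookup P i ≡ lookup Q i
      pointwise i with blockView r m i
      ... | inˡ y = trans (cycle-constant friendlyP y)
                      (trans (∷-injectiveˡ eq) (sym (cycle-constant friendlyQ y)))
      ... | inʳ v = trans (sym (lookup∘tabulate _ v))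
                      (trans (cong (λ R → lookup R v) (∷-injectiveʳ eq)) (lookup∘tabulate _ v))

    friendlyCount⁺≤ : friendlyCount G⁺ ≤ 2 ^ suc m
    friendlyCount⁺≤ = friendlyCount≤2^ G⁺ encode encode-injective

complete : ∀ n → Digraph n
complete n = record { out = λ v → ∁ ⁅ v ⁆ ; loopless = λ v → x∈p⇒x∉∁p (x∈⁅x⁆ v) }

complete-minOutDeg : ∀ {n d} → d < n → MinOutDeg≥ (complete n) d
complete-minOutDeg {suc n} (s≤s d≤n) v =
  subst (_ ≤_) (sym (trans (∣∁p∣≡n∸∣p∣ ⁅ v ⁆) (cong (suc n ∸_) (∣⁅x⁆∣≡1 v)))) d≤n

friendlyCount≤2^n : ∀ {n} (G : Digraph n) → friendlyCount G ≤ 2 ^ n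
friendlyCount≤2^n G = friendlyCount≤2^ G id (λ _ _ → id)

nonseparable⇒t-bounded : ∀ {m d} {G : Digraph m} {S} → 1 ≤ d → MinOutDeg≥ G d →
  ∣ S ∣ ≡ d ∸ 1 → Nonempty S → ¬ Separable G S →
  ∀ N → d < N → ¬ t≥ d N (suc (2 ^ suc m))
nonseparable⇒t-bounded {m} {d} {G} {S} 1≤d δ ∣S∣≡d-1 (x₀ , x₀∈S) nonseparable N d<N many =
  let H , δH , few = sparse in n≮n _ (≤-trans (many H δH) few)
  where
  sparse : ∃ λ (H : Digraph N) → MinOutDeg≥ H d × friendlyCount H ≤ 2 ^ suc m
  sparse with N ≤? suc m
  ... | yes N≤1+m = complete N , complete-minOutDeg d<N ,
                    ≤-trans (friendlyCount≤2^n (complete N)) (^-monoʳ-≤ 2 N≤1+m)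
  ... | no  N≰1+m =
    let k , 2+m+k≡N = m≤n⇒∃[o]m+o≡n (≰⇒> N≰1+m)
        open CycleGadget G S k
    in subst (λ N → ∃ λ (H : Digraph N) → MinOutDeg≥ H d × friendlyCount H ≤ 2 ^ suc m)
             (trans (cong (λ j → suc (suc j)) (+-comm k m)) 2+m+k≡N)
             (G⁺ , minOutDeg⁺ 1≤d ∣S∣≡d-1 δ , friendlyCount⁺≤ nonseparable x₀∈S)

SeparableInAll : ℕ → ℕ → Set
SeparableInAll d s = ∀ n (G : Digraph n) → MinOutDeg≥ G d → SeparableOfSize G s

TUnbounded : ℕ → Set
TUnbounded d = ∀ k → ∃ λ n → d < n × t≥ d n k

LogBound : ℕ → Set
LogBound d = ∀ n (G : Digraph n) → MinOutDeg≥ G d → n ≤ (d ∸ 2) * 2 ^ friendlyCount G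

separable⇒t-unbounded : ∀ {d} s → SeparableInAll d s → TUnbounded d
separable⇒t-unbounded {d} s separable k = suc (d + (s ∸ 1) * 2 ^ k) , s≤s (m≤m+n d _) ,
  λ G δ → ≤-trans (n≤1+n k) (separable⇒friendlyCount≥ G (separable _ G δ) k (s≤s (m≤n+m _ d)))

separable⇒log-bound : ∀ {d} → SeparableInAll d (d ∸ 1) → LogBound d
separable⇒log-bound {d} separable n G δ with n ≤? (d ∸ 2) * 2 ^ friendlyCount G
... | yes bounded = bounded
... | no  ¬bounded = contradiction
  (separable⇒friendlyCount≥ G (separable n G δ) (friendlyCount G)
    (subst (λ c → c * 2 ^ friendlyCount G < n) (sym (∸-+-assoc d 1 1)) (≰⇒> ¬bounded)))
  (n≮n _)

log-bound⇒t-unbounded : ∀ {d} → LogBound d → TUnbounded d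
log-bound⇒t-unbounded {d} bounded k = suc (d + (d ∸ 2) * 2 ^ k) , s≤s (m≤m+n d _) , many
  where
  many : t≥ d (suc (d + (d ∸ 2) * 2 ^ k)) k
  many G δ with k ≤? friendlyCount G
  ... | yes k≤count = k≤count
  ... | no  k≰count = contradiction (bounded _ G δ) (<⇒≱ (s≤s (≤-trans
    (*-monoʳ-≤ (d ∸ 2) (^-monoʳ-≤ 2 (<⇒≤ (≰⇒> k≰count)))) (m≤n+m _ d))))

t-unbounded⇒separable : ∀ {d} → 2 ≤ d → TUnbounded d → SeparableInAll d (d ∸ 1)
t-unbounded⇒separable {suc (suc e)} (s≤s (s≤s z≤n)) unbounded m G δ S ∣S∣≡1+e
  with separable? G S
... | yes separable = separable
... | no  nonseparable =
  let N , d<N , many = unbounded (suc (2 ^ suc m))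
  in ⊥-elim (nonseparable⇒t-bounded {d = suc (suc e)} {G} {S} (s≤s z≤n) δ ∣S∣≡1+e
               (∣p∣≡suc⇒nonempty S ∣S∣≡1+e) nonseparable N d<N many)

theorem1p8 : (d : ℕ) → 3 ≤ d →
    let P1 = ∃ λ (s : ℕ) → ∀ (n : ℕ) (G : Digraph n) → MinOutDeg≥ G d →
               ∀ (S : Subset n) → ∣ S ∣ ≡ s → Separable G S
        P2 = ∀ (n : ℕ) (G : Digraph n) → MinOutDeg≥ G d →
               ∀ (S : Subset n) → ∣ S ∣ ≡ d ∸ 1 → Separable G S
        P3 = ∀ (k : ℕ) → ∃ λ (n : ℕ) → d < n × t≥ d n k
        P4 = ∀ (n : ℕ) (G : Digraph n) → MinOutDeg≥ G d →
               n ≤ (d ∸ 2) * 2 ^ friendlyCount G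
    in (P1 ⇔ P2) × (P2 ⇔ P3) × (P3 ⇔ P4)
theorem1p8 d 3≤d =
    mk⇔ (λ (s , separable) → t-unbounded⇒separable 2≤d (separable⇒t-unbounded s separable))
        (d ∸ 1 ,_)
  , mk⇔ (separable⇒t-unbounded (d ∸ 1)) (t-unbounded⇒separable 2≤d)
  , mk⇔ (λ unbounded → separable⇒log-bound (t-unbounded⇒separable 2≤d unbounded))
        log-bound⇒t-unbounded
  where
  2≤d : 2 ≤ d
  2≤d = ≤-trans (n≤1+n 2) 3≤d
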